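{- For every $u \in S_n$ and every $J \subseteq [n]$, the correspondence \[ u_J \longleftrightarrow \Delta_{J\vartriangle \mathrm{Des}(u)}\, u \] is a bijection from $B_n$ to $B_n$ that is weight-preserving in the sense that \begin{align*} \mathrm{ndes}(u_J) &= \mathrm{fdes}(\Delta_{J\vartriangle \mathrm{Des}(u)}\, u), \\ \mathrm{nmaj}(u_J) &= \mathrm{fmaj}(\Delta_{J\vartriangle \mathrm{Des}(u)}\, u). \end{align*}
   Context: Let $[n]=\{1,\dots,n\}$ and let $S_n$ be the set of permutations of $[n]$. The hyperoctahedral group $B_n$ consists of all signed permutations: words $w=w_1\cdots w_n$ on the alphabet $\{\bar 1,1,\dots,\bar n,n\}$ (with $\bar i=-i$) such that $|w|=|w_1|\cdots|w_n|\in S_n$. Letters are totally ordered by $\bar 1<\bar 2<\cdots<\bar n<1<2<\cdots<n$. For a word $w$, $\mathrm{Des}(w)=\{i : w_i>w_{i+1}\}$, $\mathrm{des}(w)=|\mathrm{Des}(w)|$, and $\mathrm{maj}(w)=\sum_{i\in\mathrm{Des}(w)} i$. For $w\in B_n$: $\mathrm{ndes}(w)=\mathrm{des}(w)+|\{i: w_i<0\}|$, $\mathrm{nmaj}(w)=\mathrm{maj}(w)+\sum_{w_i<0}|w_i|$; $\mathrm{fdes}(w)=2\,\mathrm{des}(w)+1$ if $w_1<0$ and $2\,\mathrm{des}(w)$ if $w_1>0$; $\mathrm{fmaj}(w)=2\,\mathrm{maj}(w)+|\{i:w_i<0\}|$. The standardization $\mathrm{st}(w)\in S_n$ of $w\in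 B_n$ replaces the smallest letter of $w$ by $1$, the next smallest by $2$, etc. For $u\in S_n$ and $J\subseteq[n]$, $u_J$ denotes the unique $w\in B_n$ with $\mathrm{st}(w)=u$ whose set of letters is $\{i: i\in[n]\setminus J\}\cup\{\bar j: j\in J\}$ (i.e. whose negative letters are exactly $\bar j$ for $j\in J$). $\Delta_i$ is the operator negating the first $i$ letters: $\Delta_i w=\overline{w_1\cdots w_i}\,w_{i+1}\cdots w_n$. These operators commute, and for $J=\{j_1<\cdots<j_k\}$, $\Delta_J=\Delta_{j_1}\cdots\Delta_{j_k}$. $J\vartriangle \mathrm{Des}(u)$ denotes the symmetric difference of $J$ and $\mathrm{Des}(u)$. -}

module Defs where

open import Data.Nat as ℕ using (ℕ; zero; suc; _≡ᵇ_; _<ᵇ_)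
open import Data.Integer as ℤ using (ℤ; +_; -[1+_]; -_; ∣_∣)
open import Data.Bool using (Bool; true; false; if_then_else_; not; _xor_)
open import Data.List using (List; []; _∷_; _++_; map; filter; length; upTo; take; drop; foldr)
open import Data.Nat.ListAction using (sum)
open import Data.Bool.ListAction using (any)
open import Data.List.Relation.Binary.Permutation.Propositional using (_↭_)
open import Relation.Nullary.Decidable using (does)
open import Relation.Binary.PropositionalEquality using (_≡_)
open import Data.Bool.Properties using (T?)
open import Data.Unit using (⊤)

-- Words are lists of integers; the letter ī is represented by - i.

[_] : ℕ → List ℕ
[ n ] = map suc (upTo n)

IsPerm : ℕ → List ℤ → Set
IsPerm n u = u ↭ map +_ [ n ]

IsSigned : ℕ → List ℤ → Set
IsSigned n w = map ∣_∣ w ↭ [ n ]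

-- the total order  1̄ < 2̄ < ⋯ < n̄ < 1 < 2 < ⋯ < n  (strict, boolean)
_<ᴮ_ : ℤ → ℤ → Bool
(+ a)    <ᴮ (+ b)    = a <ᵇ b
(+ a)    <ᴮ -[1+ b ] = false
-[1+ a ] <ᴮ (+ b)    = true
-[1+ a ] <ᴮ -[1+ b ] = a <ᵇ b

isNeg : ℤ → Bool
isNeg (+ _)    = false
isNeg -[1+ _ ] = true

-- descent set (1-based positions) with respect to <ᴮ
desFrom : ℕ → List ℤ → List ℕ
desFrom k (a ∷ rest@(b ∷ _)) = (if b <ᴮ a then k ∷ [] else []) ++ desFrom (suc k) rest
desFrom k _ = []

Des : List ℤ → List ℕ
Des w = desFrom 1 w

des : List ℤ → ℕ
des w = length (Des w)

maj : List ℤ → ℕ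
maj w = sum (Des w)

negCount : List ℤ → ℕ
negCount w = length (filter (λ a → T? (isNeg a)) w)

negSum : List ℤ → ℕ
negSum w = sum (map ∣_∣ (filter (λ a → T? (isNeg a)) w))

ndes : List ℤ → ℕ
ndes w = des w ℕ.+ negCount w

nmaj : List ℤ → ℕ
nmaj w = maj w ℕ.+ negSum w

firstNeg : List ℤ → ℕ
firstNeg []      = 0
firstNeg (a ∷ _) = if isNeg a then 1 else 0

fdes : List ℤ → ℕ
fdes w = 2 ℕ.* des w ℕ.+ firstNeg w

fmaj : List ℤ → ℕ
fmaj w = 2 ℕ.* maj w ℕ.+ negCount w

Δ : ℕ → List ℤ → List ℤ
Δ i w = map -_ (take i w) ++ drop i w

ΔSet : List ℕ → List ℤ → List ℤ
ΔSet K w = foldr Δ w K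

_∈ᵇ_ : ℕ → List ℕ → Bool
i ∈ᵇ A = any (λ j → j ≡ᵇ i) A

_⊆[_] : List ℕ → ℕ → Set
J ⊆[ n ] = ∀ {j} → (j ∈ᵇ J) ≡ true → (1 ℕ.≤ j) Data.Product.× (j ℕ.≤ n)
  where import Data.Product

symDiff : ℕ → List ℕ → List ℕ → List ℕ
symDiff n A B = filter (λ i → T? ((i ∈ᵇ A) xor (i ∈ᵇ B))) [ n ]

st : List ℤ → List ℤ
st w = map (λ a → + suc (length (filter (λ b → T? (b <ᴮ a)) w))) w

Neg : List ℤ → List ℕ
Neg w = map ∣_∣ (filter (λ a → T? (isNeg a)) w)

nth : List ℤ → ℕ → ℤ
nth []      _       = + 0
nth (a ∷ _) zero    = a
nth (_ ∷ l) (suc k) = nth l k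

-- u_J: the word with st(u_J) = u whose letters are {i ∉ J} ∪ {j̄ : j ∈ J}.
-- The letters sorted by <ᴮ are  j̄ (j ∈ J, increasing) followed by i ∉ J (increasing);
-- the letter in position k is the u_k-th smallest one.
sortedLetters : ℕ → List ℕ → List ℤ
sortedLetters n J = map (λ j → - (+ j)) (filter (λ i → T? (i ∈ᵇ J)) [ n ])
                 ++ map +_ (filter (λ i → T? (not (i ∈ᵇ J))) [ n ])

uJ : ℕ → List ℤ → List ℕ → List ℤ
uJ n u J = map (λ k → nth (sortedLetters n J) (∣ k ∣ ℕ.∸ 1)) u

-- the correspondence u_J ↦ Δ_{J △ Des(u)} u, as a map on B_n
-- (w = u_J with u = st w and J = Neg w)
ψ : ℕ → List ℤ → List ℤ
ψ n w = ΔSet (symDiff n (Neg w) (Des (st w))) (st w)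

module Submission where

-- A composite Δ_K only changes signs: the letter in position p is negated iff
-- an odd number of k ∈ K satisfy p ≤ k.  Call this sign pattern π.  For K = J △ Des(u) it
-- is the unique solution of the backward recurrence π p = [p ∈ J] ⊕ [p ∈ Des u] ⊕ π (p+1)
-- with π (n+1) = false (a "parity chain").
--  * Weights: scanning u left to right, the contribution of each position to ndes/nmaj of
--    u_J and to fdes/fmaj of the signed word agree; this is an 8-case boolean identity.
--  * Shape of u_J: the letters of u_J, sorted for <ᴮ, form the strictly increasing list
--    sortedLetters n J, and u_J replaces the value x by its x-th entry.  Hence u_J is order
--    isomorphic to u (st u_J = u, Des u_J = Des u) and its negative letters are exactly J.
--  * Reconstruction: every w ∈ B_n equals u_J for u = st w and J = Neg w.
-- The four parts of the theorem follow: ψ(u_J) = Δ_{J△Des u} u from the shape of u_J;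
-- the weights from the scan; injectivity from reconstruction and uniqueness of parity
-- chains; surjectivity by reading J off the signs of the target word.

open import Defs
open import Data.Nat using (ℕ)
open import Data.Integer using (ℤ)
open import Data.List using (List)
open import Data.Product using (_×_; Σ-syntax)
open import Relation.Binary.PropositionalEquality using (_≡_)

open import Data.Nat using (zero; suc; _+_; _*_; _∸_; _≤_; _<_; z≤n; s≤s; _≡ᵇ_; _<ᵇ_)
open import Data.Nat.Properties
open import Data.Nat.ListAction using (sum)
open import Data.Nat.ListAction.Properties using (sum-++; sum-↭)
open import Data.Nat.Tactic.RingSolver using (solve-∀)
open import Data.Integer using (+_; -[1+_]; -_; ∣_∣)
open import Data.Integer.Properties using (neg-involutive; ∣-i∣≡∣i∣)
open import Data.Bool using (Bool; true; false; if_then_else_; not; _xor_; _∨_; _∧_; T)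
open import Data.Bool.Solver using (module xor-∧-Solver)
open import Data.Bool.Properties
  using (T?; T-≡; T-not-≡; ∨-assoc; ∨-identityʳ; ∨-zeroʳ; ∧-identityʳ; ∧-zeroʳ; xor-assoc; xor-same; xor-identityʳ)
open import Data.List using ([]; _∷_; _++_; map; filter; length; applyUpTo)
open import Data.List.Properties using (∷-injectiveˡ; ∷-injectiveʳ; length-++; map-++; map-∘; length-map; map-id-local; map-cong; map-cong-local; map-applyUpTo)
open import Data.List.Relation.Unary.All as All using (All; []; _∷_)
import Data.List.Relation.Unary.All.Properties as AllP
open import Data.List.Relation.Unary.AllPairs as AllPairs using (AllPairs; []; _∷_)
import Data.List.Relation.Unary.AllPairs.Properties as AllPairsP
open import Data.List.Relation.Unary.Any using (here; there)
open import Data.List.Membership.Propositional using (_∈_)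
open import Data.List.Membership.Propositional.Properties using (∈-map⁺; ∈-map⁻; ∈-filter⁺; ∈-filter⁻)
open import Data.List.Relation.Binary.Permutation.Propositional as Perm
  using (_↭_; prep; swap; ↭-sym; ↭-trans; ↭⇒↭ₛ)
import Data.List.Relation.Binary.Permutation.Propositional.Properties as PermP
import Data.List.Relation.Binary.Permutation.Setoid.Properties as PermSetoidP
open import Data.Product using (Σ; _,_; proj₁; proj₂)
open import Data.Sum using (_⊎_; inj₁; inj₂)
open import Data.Unit using (⊤; tt)
open import Data.Empty using (⊥; ⊥-elim)
open import Function.Base using (id)
open import Function.Bundles using (Equivalence)
open import Relation.Nullary using (¬_)
open import Relation.Binary.PropositionalEquality
  using (refl; sym; trans; cong; cong₂; subst; subst₂; module ≡-Reasoning)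
import Relation.Binary.PropositionalEquality.Properties as ≡P

module UniqueNat = PermSetoidP (≡P.setoid ℕ)

bit : Bool → ℕ
bit true  = 1
bit false = 0

T⇒true : ∀ {b} → T b → b ≡ true
T⇒true = Equivalence.to T-≡

T-not⇒false : ∀ {b} → T (not b) → b ≡ false
T-not⇒false = Equivalence.to T-not-≡

true⇒< : ∀ {m n} → (m <ᵇ n) ≡ true → m < n
true⇒< {m} {n} e = <ᵇ⇒< m n (subst T (sym e) tt)

<ᵇ-true : ∀ {m n} → m < n → (m <ᵇ n) ≡ true
<ᵇ-true m<n = T⇒true (<⇒<ᵇ m<n)

<ᵇ-false : ∀ {m n} → n ≤ m → (m <ᵇ n) ≡ false
<ᵇ-false {m} {n} n≤m with m <ᵇ n in eq
... | false = refl
... | true  = ⊥-elim (<⇒≱ (true⇒< eq) n≤m)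

≡ᵇ-refl : ∀ m → (m ≡ᵇ m) ≡ true
≡ᵇ-refl m = T⇒true (≡⇒≡ᵇ m m refl)

≡ᵇ-false : ∀ {m n} → ¬ m ≡ n → (m ≡ᵇ n) ≡ false
≡ᵇ-false {m} {n} m≢n with m ≡ᵇ n in eq
... | false = refl
... | true  = ⊥-elim (m≢n (≡ᵇ⇒≡ m n (subst T (sym eq) tt)))

xor-cancel : ∀ a b → (a xor b) xor b ≡ a
xor-cancel a b = trans (xor-assoc a b b) (trans (cong (a xor_) (xor-same b)) (xor-identityʳ a))

xor-injectiveˡ : ∀ {a b} c → a xor c ≡ b xor c → a ≡ b
xor-injectiveˡ {a} {b} c e = trans (sym (xor-cancel a c)) (trans (cong (_xor c) e) (xor-cancel b c))

xor-move : ∀ {a b} c → a ≡ b xor c → b ≡ a xor c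
xor-move {a} {b} c e = trans (sym (xor-cancel b c)) (cong (_xor c) (sym e))

xor-interchange : ∀ a b c d → (a xor b) xor (c xor d) ≡ (a xor c) xor (b xor d)
xor-interchange = solve 4 (λ a b c d → (a :+ b) :+ (c :+ d) := (a :+ c) :+ (b :+ d)) refl
  where open xor-∧-Solver

range : ℕ → ℕ → List ℕ
range c zero    = []
range c (suc m) = c ∷ range (suc c) m

applyUpTo-range : ∀ (f : ℕ → ℕ) c m → (∀ i → f i ≡ c + i) → applyUpTo f m ≡ range c m
applyUpTo-range f c zero    _ = refl
applyUpTo-range f c (suc m) h = cong₂ _∷_ (trans (h 0) (+-identityʳ c))
  (applyUpTo-range (λ i → f (suc i)) (suc c) m (λ i → trans (h (suc i)) (+-suc c i)))

[n]≡range : ∀ n → [ n ] ≡ range 1 n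
[n]≡range n = trans (map-applyUpTo id suc n) (applyUpTo-range suc 1 n (λ _ → refl))

length-range : ∀ c m → length (range c m) ≡ m
length-range c zero    = refl
length-range c (suc m) = cong suc (length-range (suc c) m)

range-≥ : ∀ c m → All (c ≤_) (range c m)
range-≥ c zero    = []
range-≥ c (suc m) = ≤-refl ∷ All.map (≤-trans (n≤1+n c)) (range-≥ (suc c) m)

range-< : ∀ c m → All (_< c + m) (range c m)
range-< c zero    = []
range-< c (suc m) = m<m+n c (s≤s z≤n) ∷ All.map (λ {x} h → subst (x <_) (sym (+-suc c m)) h) (range-< (suc c) m)

range-increasing : ∀ c m → AllPairs (λ x y → c ≤ x × x < y) (range c m)
range-increasing c zero    = []
range-increasing c (suc m) = All.map (≤-refl ,_) (range-≥ (suc c) m)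
                           ∷ AllPairs.map (λ (c<x , x<y) → <⇒≤ c<x , x<y) (range-increasing (suc c) m)

window-empty : ∀ {c x} → c ≤ x → x < c + 0 → ⊥
window-empty {c} {x} c≤x x< = <⇒≱ (subst (x <_) (+-identityʳ c) x<) c≤x

window-split : ∀ {c m x} → c ≤ x → x < c + suc m → x ≡ c ⊎ (suc c ≤ x × x < suc c + m)
window-split {c} {m} {x} c≤x x< with m≤n⇒m<n∨m≡n c≤x
... | inj₂ refl = inj₁ refl
... | inj₁ c<x  = inj₂ (c<x , subst (x <_) (+-suc c m) x<)

window-tail : ∀ {c m x} → suc c ≤ x → x < suc c + m → c ≤ x × x < c + suc m
window-tail {c} {m} {x} c<x x< = ≤-trans (n≤1+n c) c<x , subst (x <_) (sym (+-suc c m)) x<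

count : {A : Set} → (A → Bool) → List A → ℕ
count P l = length (filter (λ x → T? (P x)) l)

count-↭ : {A : Set} (P : A → Bool) {xs ys : List A} → xs ↭ ys → count P xs ≡ count P ys
count-↭ P p = PermP.↭-length (PermP.filter-↭ (λ x → T? (P x)) p)

count-none : {A : Set} (P : A → Bool) (l : List A) → All (λ x → P x ≡ false) l → count P l ≡ 0
count-none P [] [] = refl
count-none P (x ∷ l) (h ∷ hs) with P x | h
... | false | refl = count-none P l hs

filter-cong-local : {A : Set} (P Q : A → Bool) (l : List A) → All (λ x → P x ≡ Q x) l →
                    filter (λ x → T? (P x)) l ≡ filter (λ x → T? (Q x)) l
filter-cong-local P Q [] [] = refl
filter-cong-local P Q (x ∷ l) (h ∷ hs) with P x | Q x | h
... | true  | true  | refl = cong (x ∷_) (filter-cong-local P Q l hs)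
... | false | false | refl = filter-cong-local P Q l hs

partition-↭ : {A : Set} (P : A → Bool) (l : List A) →
              filter (λ x → T? (P x)) l ++ filter (λ x → T? (not (P x))) l ↭ l
partition-↭ P [] = Perm.refl
partition-↭ P (x ∷ l) with P x
... | true  = prep x (partition-↭ P l)
... | false = ↭-trans (PermP.shift x (filter (λ x → T? (P x)) l) (filter (λ x → T? (not (P x))) l))
                      (prep x (partition-↭ P l))

∈ᵇ-++ : ∀ i xs ys → i ∈ᵇ (xs ++ ys) ≡ (i ∈ᵇ xs) ∨ (i ∈ᵇ ys)
∈ᵇ-++ i []       ys = refl
∈ᵇ-++ i (x ∷ xs) ys = trans (cong ((x ≡ᵇ i) ∨_) (∈ᵇ-++ i xs ys)) (sym (∨-assoc (x ≡ᵇ i) (i ∈ᵇ xs) (i ∈ᵇ ys)))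

∉ᵇ-above : ∀ i xs → All (suc i ≤_) xs → i ∈ᵇ xs ≡ false
∉ᵇ-above i []       []       = refl
∉ᵇ-above i (x ∷ xs) (h ∷ hs) rewrite ≡ᵇ-false {x} {i} (λ e → <-irrefl (sym e) h) = ∉ᵇ-above i xs hs

∈⇒∈ᵇ : ∀ {x} l → x ∈ l → x ∈ᵇ l ≡ true
∈⇒∈ᵇ (y ∷ l) (here refl) rewrite ≡ᵇ-refl y = refl
∈⇒∈ᵇ (y ∷ l) (there x∈l) = trans (cong (_ ∨_) (∈⇒∈ᵇ l x∈l)) (∨-zeroʳ _)

∈ᵇ⇒∈ : ∀ {x} l → x ∈ᵇ l ≡ true → x ∈ l
∈ᵇ⇒∈ {x} (y ∷ l) h with y ≡ᵇ x in eq
... | true  = here (sym (≡ᵇ⇒≡ y x (subst T (sym eq) tt)))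
... | false = there (∈ᵇ⇒∈ l h)

∈ᵇ-↭ : ∀ i {xs ys} → xs ↭ ys → i ∈ᵇ xs ≡ i ∈ᵇ ys
∈ᵇ-↭ i Perm.refl          = refl
∈ᵇ-↭ i (prep x p)         = cong ((x ≡ᵇ i) ∨_) (∈ᵇ-↭ i p)
∈ᵇ-↭ i (swap x y p) rewrite ∈ᵇ-↭ i p with x ≡ᵇ i | y ≡ᵇ i
... | true  | true  = refl
... | true  | false = refl
... | false | _     = refl
∈ᵇ-↭ i (Perm.trans p q)   = trans (∈ᵇ-↭ i p) (∈ᵇ-↭ i q)

∈ᵇ-filter-range : ∀ (P : ℕ → Bool) c m i → c ≤ i → i < c + m →
                  i ∈ᵇ filter (λ j → T? (P j)) (range c m) ≡ P i
∈ᵇ-filter-range P c zero    i c≤i i< = ⊥-elim (window-empty c≤i i<)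
∈ᵇ-filter-range P c (suc m) i c≤i i< with window-split c≤i i<
∈ᵇ-filter-range P c (suc m) .c c≤i i< | inj₁ refl with P c
... | true  rewrite ≡ᵇ-refl c = refl
... | false = ∉ᵇ-above c _ (AllP.filter⁺ (λ j → T? (P j)) (range-≥ (suc c) m))
∈ᵇ-filter-range P c (suc m) i c≤i i< | inj₂ (c<i , i<′) with P c
... | true  rewrite ≡ᵇ-false {c} {i} (λ e → <-irrefl e c<i) = ∈ᵇ-filter-range P (suc c) m i c<i i<′
... | false = ∈ᵇ-filter-range P (suc c) m i c<i i<′

-- negateWhere π k u negates the letter of u in position p (positions numbered from k)
-- exactly when π p holds.  Every composite Δ_K acts in this way (ΔSet-as-pattern).
negateWhere : (ℕ → Bool) → ℕ → List ℤ → List ℤ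
negateWhere π k []      = []
negateWhere π k (a ∷ r) = (if π k then - a else a) ∷ negateWhere π (suc k) r

negateWhere-cong : ∀ π π′ k u → (∀ p → k ≤ p → p < k + length u → π p ≡ π′ p) →
                   negateWhere π k u ≡ negateWhere π′ k u
negateWhere-cong π π′ k []      h = refl
negateWhere-cong π π′ k (a ∷ r) h rewrite h k ≤-refl (m<m+n k (s≤s z≤n)) =
  cong (_ ∷_) (negateWhere-cong π π′ (suc k) r (λ p k<p p< → h p (proj₁ (window-tail k<p p<)) (proj₂ (window-tail k<p p<))))

Δ-negateWhere : ∀ i π k u → Δ i (negateWhere π k u) ≡ negateWhere (λ p → (p <ᵇ k + i) xor π p) k u
Δ-negateWhere zero    π k u       = negateWhere-cong π _ k u
  (λ p k≤p _ → cong (_xor π p) (sym (<ᵇ-false (subst (_≤ p) (sym (+-identityʳ k)) k≤p))))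
Δ-negateWhere (suc i) π k []      = refl
Δ-negateWhere (suc i) π k (a ∷ r) = cong₂ _∷_ head-letter rest
  where
  head-letter : - (if π k then - a else a) ≡ (if (k <ᵇ k + suc i) xor π k then - a else a)
  head-letter rewrite <ᵇ-true {k} {k + suc i} (m<m+n k (s≤s z≤n)) with π k
  ... | true  = neg-involutive a
  ... | false = refl
  rest : Δ i (negateWhere π (suc k) r) ≡ negateWhere (λ p → (p <ᵇ k + suc i) xor π p) (suc k) r
  rest = trans (Δ-negateWhere i π (suc k) r)
               (negateWhere-cong _ _ (suc k) r (λ p _ _ → cong (λ z → (p <ᵇ z) xor π p) (sym (+-suc k i))))

-- The sign pattern of Δ_K: position p is negated iff an odd number of k ∈ K have p ≤ k.
flipParity : List ℕ → ℕ → Bool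
flipParity []      p = false
flipParity (k ∷ K) p = (p <ᵇ suc k) xor flipParity K p

negateWhere-none : ∀ k u → negateWhere (λ _ → false) k u ≡ u
negateWhere-none k []      = refl
negateWhere-none k (a ∷ r) = cong (a ∷_) (negateWhere-none (suc k) r)

ΔSet-as-pattern : ∀ K u → ΔSet K u ≡ negateWhere (flipParity K) 1 u
ΔSet-as-pattern []      u = sym (negateWhere-none 1 u)
ΔSet-as-pattern (k ∷ K) u = trans (cong (Δ k) (ΔSet-as-pattern K u)) (Δ-negateWhere k (flipParity K) 1 u)

negateWhere-invariant : {B : Set} (f : ℤ → B) → (∀ a → f (- a) ≡ f a) →
                        ∀ π k u → map f (negateWhere π k u) ≡ map f u
negateWhere-invariant f f-even π k []      = refl
negateWhere-invariant f f-even π k (a ∷ r) = cong₂ _∷_ head-letter (negateWhere-invariant f f-even π (suc k) r)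
  where
  head-letter : f (if π k then - a else a) ≡ f a
  head-letter with π k
  ... | true  = f-even a
  ... | false = refl

Pos : ℤ → Set
Pos a = Σ ℕ λ m → a ≡ + suc m

negateWhere-injective : ∀ π π′ k u → All Pos u → negateWhere π k u ≡ negateWhere π′ k u →
                        ∀ p → k ≤ p → p < k + length u → π p ≡ π′ p
negateWhere-injective π π′ k [] [] e p k≤p p< = ⊥-elim (window-empty k≤p p<)
negateWhere-injective π π′ k (a ∷ r) ((m , refl) ∷ ps) e p k≤p p< with window-split k≤p p<
... | inj₁ refl = sign-of-head (π k) (π′ k) (∷-injectiveˡ e)
  where
  sign-of-head : ∀ b b′ → (if b then - (+ suc m) else + suc m) ≡ (if b′ then - (+ suc m) else + suc m) → b ≡ b′
  sign-of-head true  true  _ = refl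
  sign-of-head false false _ = refl
  sign-of-head true  false ()
  sign-of-head false true  ()
... | inj₂ (k<p , p<′) = negateWhere-injective π π′ (suc k) r ps (∷-injectiveʳ e) p k<p p<′

negateWhere-signs : ∀ v π k → (∀ i → i < length v → π (k + i) ≡ isNeg (nth v i)) →
                    negateWhere π k (map (λ a → + ∣ a ∣) v) ≡ v
negateWhere-signs []      π k h = refl
negateWhere-signs (a ∷ v) π k h = cong₂ _∷_ (restore (π k) a (trans (cong π (sym (+-identityʳ k))) (h 0 (s≤s z≤n))))
  (negateWhere-signs v π (suc k) (λ i i< → trans (cong π (sym (+-suc k i))) (h (suc i) (s≤s i<))))
  where
  restore : ∀ b a → b ≡ isNeg a → (if b then - (+ ∣ a ∣) else + ∣ a ∣) ≡ a
  restore .false (+ m)    refl = refl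
  restore .true  -[1+ m ] refl = refl

negCount-negateWhere : ∀ π k x r → negCount (negateWhere π k (+ suc x ∷ r)) ≡ bit (π k) + negCount (negateWhere π (suc k) r)
negCount-negateWhere π k x r with π k
... | true  = refl
... | false = refl

firstNeg-negateWhere : ∀ π m r → firstNeg (negateWhere π 1 (+ suc m ∷ r)) ≡ bit (π 1)
firstNeg-negateWhere π m r with π 1
... | true  = refl
... | false = refl

occursOdd : List ℕ → ℕ → Bool
occursOdd []      p = false
occursOdd (k ∷ L) p = (p ≡ᵇ k) xor occursOdd L p

<ᵇ-suc : ∀ p k → (p <ᵇ suc k) ≡ (p ≡ᵇ k) xor (p <ᵇ k)
<ᵇ-suc zero    zero    = refl
<ᵇ-suc zero    (suc k) = refl
<ᵇ-suc (suc p) zero    = refl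
<ᵇ-suc (suc p) (suc k) = <ᵇ-suc p k

flipParity-step : ∀ K p → flipParity K p ≡ occursOdd K p xor flipParity K (suc p)
flipParity-step []      p = refl
flipParity-step (k ∷ K) p rewrite <ᵇ-suc p k | flipParity-step K p =
  xor-interchange (p ≡ᵇ k) (p <ᵇ k) (occursOdd K p) (flipParity K (suc p))

flipParity-above : ∀ K n → All (_≤ n) K → flipParity K (suc n) ≡ false
flipParity-above []      n []         = refl
flipParity-above (k ∷ K) n (k≤n ∷ hs) rewrite <ᵇ-false {n} {k} k≤n = flipParity-above K n hs

occursOdd-below : ∀ (P : ℕ → Bool) c m p → p < c → occursOdd (filter (λ i → T? (P i)) (range c m)) p ≡ false
occursOdd-below P c zero    p p<c = refl
occursOdd-below P c (suc m) p p<c with P c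
... | true  rewrite ≡ᵇ-false {p} {c} (λ e → <-irrefl e p<c) = occursOdd-below P (suc c) m p (≤-trans p<c (n≤1+n c))
... | false = occursOdd-below P (suc c) m p (≤-trans p<c (n≤1+n c))

-- A filtered window has no repetitions, so "odd multiplicity" is the filtering predicate.
occursOdd-filter-range : ∀ (P : ℕ → Bool) c m p → c ≤ p → p < c + m →
                         occursOdd (filter (λ i → T? (P i)) (range c m)) p ≡ P p
occursOdd-filter-range P c zero    p c≤p p< = ⊥-elim (window-empty c≤p p<)
occursOdd-filter-range P c (suc m) p c≤p p< with window-split c≤p p<
occursOdd-filter-range P c (suc m) .c c≤p p< | inj₁ refl with P c
... | true  rewrite ≡ᵇ-refl c | occursOdd-below P (suc c) m c ≤-refl = refl
... | false = occursOdd-below P (suc c) m c ≤-refl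
occursOdd-filter-range P c (suc m) p c≤p p< | inj₂ (c<p , p<′) with P c
... | true  rewrite ≡ᵇ-false {p} {c} (λ e → <-irrefl (sym e) c<p) = occursOdd-filter-range P (suc c) m p c<p p<′
... | false = occursOdd-filter-range P (suc c) m p c<p p<′

ParityChain : (ℕ → Bool) → (ℕ → Bool) → ℕ → List ℤ → Set
ParityChain π P k []      = π k ≡ false
ParityChain π P k (a ∷ r) = (π k ≡ P k xor π (suc k)) × ParityChain π P (suc k) r

parityChain-intro : ∀ π P k u → (∀ p → k ≤ p → p < k + length u → π p ≡ P p xor π (suc p)) →
                    π (k + length u) ≡ false → ParityChain π P k u
parityChain-intro π P k []      h e = subst (λ z → π z ≡ false) (+-identityʳ k) e
parityChain-intro π P k (a ∷ r) h e = h k ≤-refl (m<m+n k (s≤s z≤n)) ,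
  parityChain-intro π P (suc k) r (λ p k<p p< → h p (proj₁ (window-tail k<p p<)) (proj₂ (window-tail k<p p<)))
    (subst (λ z → π z ≡ false) (+-suc k (length r)) e)

parityChain-step : ∀ π P k u → ParityChain π P k u → ∀ p → k ≤ p → p < k + length u → π p ≡ P p xor π (suc p)
parityChain-step π P k []      h       p k≤p p< = ⊥-elim (window-empty k≤p p<)
parityChain-step π P k (a ∷ r) (h , hs) p k≤p p< with window-split k≤p p<
... | inj₁ refl        = h
... | inj₂ (k<p , p<′) = parityChain-step π P (suc k) r hs p k<p p<′

parityChain-end : ∀ π P k u → ParityChain π P k u → π (k + length u) ≡ false
parityChain-end π P k []      h        = trans (cong π (+-identityʳ k)) h
parityChain-end π P k (a ∷ r) (_ , hs) = trans (cong π (+-suc k (length r))) (parityChain-end π P (suc k) r hs)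

parityChain-unique : ∀ π π′ P k u → ParityChain π P k u → ParityChain π′ P k u →
                     ∀ p → k ≤ p → p ≤ k + length u → π p ≡ π′ p
parityChain-unique π π′ P k [] h h′ p k≤p p≤ with ≤-antisym k≤p (subst (p ≤_) (+-identityʳ k) p≤)
... | refl = trans h (sym h′)
parityChain-unique π π′ P k (a ∷ r) (h , hs) (h′ , hs′) p k≤p p≤ with m≤n⇒m<n∨m≡n k≤p
... | inj₂ refl = trans h (trans (cong (P k xor_) next) (sym h′))
  where
  next : π (suc k) ≡ π′ (suc k)
  next = parityChain-unique π π′ P (suc k) r hs hs′ (suc k) ≤-refl (s≤s (m≤m+n k (length r)))
... | inj₁ k<p  = parityChain-unique π π′ P (suc k) r hs hs′ p k<p (subst (p ≤_) (+-suc k (length r)) p≤)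

flipParity-chain : ∀ (P : ℕ → Bool) u → ParityChain (flipParity (filter (λ i → T? (P i)) (range 1 (length u)))) P 1 u
flipParity-chain P u = parityChain-intro π P 1 u step (flipParity-above K (length u) K≤)
  where
  K = filter (λ i → T? (P i)) (range 1 (length u))
  π = flipParity K
  K≤ : All (_≤ length u) K
  K≤ = AllP.filter⁺ (λ i → T? (P i)) (All.map (λ { (s≤s h) → h }) (range-< 1 (length u)))
  step : ∀ p → 1 ≤ p → p < 1 + length u → π p ≡ P p xor π (suc p)
  step p 1≤p p< = trans (flipParity-step K p) (cong (_xor π (suc p)) (occursOdd-filter-range P 1 (length u) p 1≤p p<))

descentAt : Bool → ℕ → List ℕ
descentAt b k = if b then k ∷ [] else []

length-descentAt : ∀ b k → length (descentAt b k) ≡ bit b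
length-descentAt true  k = refl
length-descentAt false k = refl

sum-descentAt : ∀ b k → sum (descentAt b k) ≡ k * bit b
sum-descentAt true  k = trans (+-identityʳ k) (sym (*-identityʳ k))
sum-descentAt false k = sym (*-zeroʳ k)

desFrom-≥ : ∀ k u → All (k ≤_) (desFrom k u)
desFrom-≥ k []          = []
desFrom-≥ k (a ∷ [])    = []
desFrom-≥ k (a ∷ b ∷ r) = AllP.++⁺ (first (b <ᴮ a)) (All.map (≤-trans (n≤1+n k)) (desFrom-≥ (suc k) (b ∷ r)))
  where
  first : ∀ d → All (k ≤_) (descentAt d k)
  first true  = ≤-refl ∷ []
  first false = []

desFrom-relabel : ∀ {Q : ℕ → Set} k (f g : ℕ → ℤ) l → All Q l →
                  (∀ {x y} → Q x → Q y → (f y <ᴮ f x) ≡ (g y <ᴮ g x)) → desFrom k (map f l) ≡ desFrom k (map g l)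
desFrom-relabel k f g []          _              h = refl
desFrom-relabel k f g (x ∷ [])    _              h = refl
desFrom-relabel k f g (x ∷ y ∷ r) (qx ∷ qy ∷ qs) h =
  cong₂ (λ b z → descentAt b k ++ z) (h qx qy) (desFrom-relabel (suc k) f g (y ∷ r) (qy ∷ qs) h)

DescentIndicator : (ℕ → Bool) → ℕ → List ℤ → Set
DescentIndicator D k []          = ⊤
DescentIndicator D k (a ∷ [])    = D k ≡ false
DescentIndicator D k (a ∷ b ∷ r) = (D k ≡ (b <ᴮ a)) × DescentIndicator D (suc k) (b ∷ r)

∈ᵇ-descentAt : ∀ d k i → i ∈ᵇ descentAt d k ≡ (d ∧ (k ≡ᵇ i))
∈ᵇ-descentAt true  k i = ∨-identityʳ (k ≡ᵇ i)
∈ᵇ-descentAt false k i = refl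

descentIndicator-intro : ∀ D k u → (∀ i → k ≤ i → D i ≡ i ∈ᵇ desFrom k u) → DescentIndicator D k u
descentIndicator-intro D k []          h = tt
descentIndicator-intro D k (a ∷ [])    h = h k ≤-refl
descentIndicator-intro D k (a ∷ b ∷ r) h = at-k , descentIndicator-intro D (suc k) (b ∷ r) beyond-k
  where
  open ≡-Reasoning
  d = b <ᴮ a
  rest = desFrom (suc k) (b ∷ r)
  at-k : D k ≡ d
  at-k = begin
    D k                          ≡⟨ h k ≤-refl ⟩
    k ∈ᵇ (descentAt d k ++ rest) ≡⟨ ∈ᵇ-++ k (descentAt d k) rest ⟩
    (k ∈ᵇ descentAt d k) ∨ (k ∈ᵇ rest)
      ≡⟨ cong₂ _∨_ (trans (∈ᵇ-descentAt d k k) (cong (d ∧_) (≡ᵇ-refl k))) (∉ᵇ-above k rest (desFrom-≥ (suc k) (b ∷ r))) ⟩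
    (d ∧ true) ∨ false           ≡⟨ trans (∨-identityʳ _) (∧-identityʳ d) ⟩
    d ∎
  beyond-k : ∀ i → suc k ≤ i → D i ≡ i ∈ᵇ rest
  beyond-k i k<i = begin
    D i                          ≡⟨ h i (≤-trans (n≤1+n k) k<i) ⟩
    i ∈ᵇ (descentAt d k ++ rest) ≡⟨ ∈ᵇ-++ i (descentAt d k) rest ⟩
    (i ∈ᵇ descentAt d k) ∨ (i ∈ᵇ rest)
      ≡⟨ cong (_∨ (i ∈ᵇ rest)) (trans (∈ᵇ-descentAt d k i) (trans (cong (d ∧_) (≡ᵇ-false {k} {i} (λ e → <-irrefl e k<i))) (∧-zeroʳ d))) ⟩
    i ∈ᵇ rest ∎

count-range-step : ∀ (J : ℕ → Bool) k m → count J (range k (suc m)) ≡ bit (J k) + count J (range (suc k) m)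
count-range-step J k m with J k
... | true  = refl
... | false = refl

sumWhere : (ℕ → Bool) → List ℕ → ℕ
sumWhere J l = sum (filter (λ i → T? (J i)) l)

sumWhere-range-step : ∀ (J : ℕ → Bool) k m → sumWhere J (range k (suc m)) ≡ k * bit (J k) + sumWhere J (range (suc k) m)
sumWhere-range-step J k m with J k
... | true  rewrite *-identityʳ k = refl
... | false rewrite *-zeroʳ k     = refl

-- Whether a pair of adjacent positive letters x, y with d = [y < x] is still a descent
-- after giving them the signs p, q.
signedDescent : Bool → Bool → Bool → Bool
signedDescent false false d = d
signedDescent true  true  d = d
signedDescent false true  d = true
signedDescent true  false d = false

signedDescent-spec : ∀ p q x y → ((if q then - (+ suc y) else + suc y) <ᴮ (if p then - (+ suc x) else + suc x))
                                 ≡ signedDescent p q (y <ᵇ x)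
signedDescent-spec false false x y = refl
signedDescent-spec false true  x y = refl
signedDescent-spec true  false x y = refl
signedDescent-spec true  true  x y = refl

-- At a position with j = [negative in u_J], d = [descent of u],
-- q = sign of the next position and p = j ⊕ d ⊕ q its own sign, one has
-- d + j + q = 2·[signed descent] + p; summed over positions, q telescopes against p.
local-weight : ∀ j d q → bit d + bit j + bit q ≡ 2 * bit (signedDescent ((j xor d) xor q) q d) + bit ((j xor d) xor q)
local-weight false false false = refl
local-weight false false true  = refl
local-weight false true  false = refl
local-weight false true  true  = refl
local-weight true  false false = refl
local-weight true  false true  = refl
local-weight true  true  false = refl
local-weight true  true  true  = refl

length-descentAt-++ : ∀ b k l → length (descentAt b k ++ l) ≡ bit b + length l
length-descentAt-++ b k l = trans (length-++ (descentAt b k)) (cong (_+ length l) (length-descentAt b k))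

sum-descentAt-++ : ∀ b k l → sum (descentAt b k ++ l) ≡ k * bit b + sum l
sum-descentAt-++ b k l = trans (sum-++ (descentAt b k) l) (cong (_+ sum l) (sum-descentAt b k))

scan-step-des : ∀ (J : ℕ → Bool) k m d e p q (L L′ : List ℕ) →
  length L + count J (range (suc k) m) ≡ 2 * length L′ + bit q →
  bit d + bit (J k) + bit q ≡ 2 * bit e + bit p →
  length (descentAt d k ++ L) + count J (range k (suc m)) ≡ 2 * length (descentAt e k ++ L′) + bit p
scan-step-des J k m d e p q L L′ ih local = begin
  length (descentAt d k ++ L) + count J (range k (suc m))
    ≡⟨ cong₂ _+_ (length-descentAt-++ d k L) (count-range-step J k m) ⟩
  bit d + length L + (bit (J k) + count J (range (suc k) m))
    ≡⟨ regroup (bit d) (bit (J k)) (length L) (count J (range (suc k) m)) ⟩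
  (bit d + bit (J k)) + (length L + count J (range (suc k) m))
    ≡⟨ cong (λ z → (bit d + bit (J k)) + z) ih ⟩
  (bit d + bit (J k)) + (2 * length L′ + bit q)
    ≡⟨ collect (bit d) (bit (J k)) (bit q) (length L′) ⟩
  (bit d + bit (J k) + bit q) + 2 * length L′
    ≡⟨ cong (_+ 2 * length L′) local ⟩
  (2 * bit e + bit p) + 2 * length L′
    ≡⟨ expand (bit e) (bit p) (length L′) ⟩
  2 * (bit e + length L′) + bit p
    ≡⟨ cong (λ z → 2 * z + bit p) (sym (length-descentAt-++ e k L′)) ⟩
  2 * length (descentAt e k ++ L′) + bit p ∎
  where
  open ≡-Reasoning
  regroup : ∀ d j L C → d + L + (j + C) ≡ (d + j) + (L + C)
  regroup = solve-∀
  collect : ∀ d j q L′ → (d + j) + (2 * L′ + q) ≡ (d + j + q) + 2 * L′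
  collect = solve-∀
  expand : ∀ e p L′ → (2 * e + p) + 2 * L′ ≡ 2 * (e + L′) + p
  expand = solve-∀

scan-step-maj : ∀ (J : ℕ → Bool) k₀ m d e p q N (L L′ : List ℕ) →
  sum L + sumWhere J (range (suc (suc k₀)) m) ≡ 2 * sum L′ + N + suc k₀ * bit q →
  bit d + bit (J (suc k₀)) + bit q ≡ 2 * bit e + bit p →
  sum (descentAt d (suc k₀) ++ L) + sumWhere J (range (suc k₀) (suc m))
    ≡ 2 * sum (descentAt e (suc k₀) ++ L′) + (bit p + N) + k₀ * bit p
scan-step-maj J k₀ m d e p q N L L′ ih local = begin
  sum (descentAt d k ++ L) + sumWhere J (range k (suc m))
    ≡⟨ cong₂ _+_ (sum-descentAt-++ d k L) (sumWhere-range-step J k m) ⟩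
  k * bit d + sum L + (k * bit (J k) + sumWhere J (range (suc k) m))
    ≡⟨ regroup k₀ (bit d) (bit (J k)) (sum L) (sumWhere J (range (suc k) m)) ⟩
  k * (bit d + bit (J k)) + (sum L + sumWhere J (range (suc k) m))
    ≡⟨ cong (λ z → k * (bit d + bit (J k)) + z) ih ⟩
  k * (bit d + bit (J k)) + (2 * sum L′ + N + k * bit q)
    ≡⟨ collect k₀ (bit d) (bit (J k)) (bit q) (sum L′) N ⟩
  k * (bit d + bit (J k) + bit q) + 2 * sum L′ + N
    ≡⟨ cong (λ z → k * z + 2 * sum L′ + N) local ⟩
  k * (2 * bit e + bit p) + 2 * sum L′ + N
    ≡⟨ expand k₀ (bit e) (bit p) (sum L′) N ⟩
  2 * (k * bit e + sum L′) + (bit p + N) + k₀ * bit p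
    ≡⟨ cong (λ z → 2 * z + (bit p + N) + k₀ * bit p) (sym (sum-descentAt-++ e k L′)) ⟩
  2 * sum (descentAt e k ++ L′) + (bit p + N) + k₀ * bit p ∎
  where
  open ≡-Reasoning
  k = suc k₀
  regroup : ∀ k₀ d j S C → suc k₀ * d + S + (suc k₀ * j + C) ≡ suc k₀ * (d + j) + (S + C)
  regroup = solve-∀
  collect : ∀ k₀ d j q S′ N → suc k₀ * (d + j) + (2 * S′ + N + suc k₀ * q) ≡ suc k₀ * (d + j + q) + 2 * S′ + N
  collect = solve-∀
  expand : ∀ k₀ e p S′ N → suc k₀ * (2 * e + p) + 2 * S′ + N ≡ 2 * (suc k₀ * e + S′) + (p + N) + k₀ * p
  expand = solve-∀

weight-scan : ∀ J D π k₀ a r → All Pos (a ∷ r) → DescentIndicator D (suc k₀) (a ∷ r) →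
              ParityChain π (λ i → J i xor D i) (suc k₀) (a ∷ r) →
              let k = suc k₀ ; u = a ∷ r ; v = negateWhere π k u in
                (length (desFrom k u) + count J (range k (length u)) ≡ 2 * length (desFrom k v) + bit (π k))
              × (sum (desFrom k u) + sumWhere J (range k (length u)) ≡ 2 * sum (desFrom k v) + negCount v + k₀ * bit (π k))
weight-scan J D π k₀ .(+ suc x) [] ((x , refl) ∷ []) last-not-descent (π-last , π-after) = des-part , maj-part
  where
  k = suc k₀
  π≡J : π k ≡ J k
  π≡J = trans π-last (trans (cong₂ (λ z w → (J k xor z) xor w) last-not-descent π-after) (xor-cancel (J k) false))
  des-part : count J (range k 1) ≡ bit (π k)
  des-part = trans (count-range-step J k 0) (trans (+-identityʳ _) (cong bit (sym π≡J)))
  maj-part : sumWhere J (range k 1) ≡ negCount (negateWhere π k (+ suc x ∷ [])) + k₀ * bit (π k)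
  maj-part = begin
    sumWhere J (range k 1)  ≡⟨ trans (sumWhere-range-step J k 0) (+-identityʳ _) ⟩
    k * bit (J k)           ≡⟨ cong (λ z → k * bit z) (sym π≡J) ⟩
    k * bit (π k)           ≡⟨ cong (_+ k₀ * bit (π k)) (sym (trans (negCount-negateWhere π k x []) (+-identityʳ _))) ⟩
    negCount (negateWhere π k (+ suc x ∷ [])) + k₀ * bit (π k) ∎
    where open ≡-Reasoning
weight-scan J D π k₀ .(+ suc x) (.(+ suc y) ∷ r) ((x , refl) ∷ (y , refl) ∷ ps) (D-here , D-rest) (π-here , π-rest) =
  subst (λ z → _ ≡ 2 * length (descentAt z k ++ desFrom (suc k) v′) + bit p) (sym e-spec)
        (scan-step-des J k (length u′) d e p q _ _ (proj₁ ih) local) ,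
  subst₂ (λ z N → _ ≡ 2 * sum (descentAt z k ++ desFrom (suc k) v′) + N + k₀ * bit p) (sym e-spec)
         (sym (negCount-negateWhere π k x u′))
         (scan-step-maj J k₀ (length u′) d e p q (negCount v′) _ _ (proj₂ ih) local)
  where
  k = suc k₀
  u′ = + suc y ∷ r
  v′ = negateWhere π (suc k) u′
  ih = weight-scan J D π k (+ suc y) r ((y , refl) ∷ ps) D-rest π-rest
  d = y <ᵇ x
  q = π (suc k)
  p = π k
  e = signedDescent p q d
  e-spec = signedDescent-spec p q x y
  local : bit d + bit (J k) + bit q ≡ 2 * bit e + bit p
  local = subst (λ P → bit d + bit (J k) + bit q ≡ 2 * bit (signedDescent P q d) + bit P)
                (sym (trans π-here (cong (λ z → (J k xor z) xor q) D-here))) (local-weight (J k) d q)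

weight-identity : ∀ (J : ℕ → Bool) u → All Pos u →
  let π = flipParity (filter (λ i → T? (J i xor (i ∈ᵇ Des u))) (range 1 (length u))) in
    (length (Des u) + count J (range 1 (length u)) ≡ fdes (negateWhere π 1 u))
  × (sum (Des u) + sumWhere J (range 1 (length u)) ≡ fmaj (negateWhere π 1 u))
weight-identity J [] [] = refl , refl
weight-identity J (.(+ suc m) ∷ r) ((m , refl) ∷ ps) =
  trans (proj₁ scan) (cong (λ z → 2 * length (desFrom 1 v) + z) (sym (firstNeg-negateWhere π m r))) ,
  trans (proj₂ scan) (+-identityʳ _)
  where
  u = + suc m ∷ r
  P = λ i → J i xor (i ∈ᵇ Des u)
  π = flipParity (filter (λ i → T? (P i)) (range 1 (length u)))
  v = negateWhere π 1 u
  scan = weight-scan J (λ i → i ∈ᵇ Des u) π 0 (+ suc m) r ((m , refl) ∷ ps)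
           (descentIndicator-intro _ 1 u (λ i _ → refl)) (flipParity-chain P u)

<ᴮ-irrefl : ∀ a → (a <ᴮ a) ≡ false
<ᴮ-irrefl (+ m)    = <ᵇ-false {m} ≤-refl
<ᴮ-irrefl -[1+ m ] = <ᵇ-false {m} ≤-refl

<ᴮ-asym : ∀ a b → (a <ᴮ b) ≡ true → (b <ᴮ a) ≡ false
<ᴮ-asym (+ x)    (+ y)    h = <ᵇ-false {y} {x} (<⇒≤ (true⇒< {x} {y} h))
<ᴮ-asym (+ x)    -[1+ y ] ()
<ᴮ-asym -[1+ x ] (+ y)    h = refl
<ᴮ-asym -[1+ x ] -[1+ y ] h = <ᵇ-false {y} {x} (<⇒≤ (true⇒< {x} {y} h))

Increasing : List ℤ → Set
Increasing = AllPairs (λ a b → (a <ᴮ b) ≡ true)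

All-nth : ∀ {P : ℤ → Set} S i → All P S → i < length S → P (nth S i)
All-nth (a ∷ S) zero    (pa ∷ _)  _       = pa
All-nth (a ∷ S) (suc i) (_ ∷ ps) (s≤s i<) = All-nth S i ps i<

increasing-nth : ∀ S i j → Increasing S → i < length S → j < length S → (nth S i <ᴮ nth S j) ≡ (i <ᵇ j)
increasing-nth (a ∷ S) zero    zero    _         _        _        = <ᴮ-irrefl a
increasing-nth (a ∷ S) zero    (suc j) (a< ∷ _)  _        (s≤s j<) = All-nth S j a< j<
increasing-nth (a ∷ S) (suc i) zero    (a< ∷ _)  (s≤s i<) _        = <ᴮ-asym a _ (All-nth S i a< i<)
increasing-nth (a ∷ S) (suc i) (suc j) (_ ∷ inc) (s≤s i<) (s≤s j<) = increasing-nth S i j inc i< j<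

increasing-rank : ∀ S i → Increasing S → i < length S → count (_<ᴮ nth S i) S ≡ i
increasing-rank (a ∷ S) zero (a< ∷ _) _ rewrite <ᴮ-irrefl a =
  count-none (_<ᴮ a) S (All.map (λ {b} a<b → <ᴮ-asym a b a<b) a<)
increasing-rank (a ∷ S) (suc i) (a< ∷ inc) (s≤s i<) rewrite All-nth S i a< i< =
  cong suc (increasing-rank S i inc i<)

nth-index : ∀ {a} S → a ∈ S → Σ ℕ λ i → i < length S × nth S i ≡ a
nth-index (b ∷ S) (here refl) = 0 , s≤s z≤n , refl
nth-index (b ∷ S) (there a∈S) with nth-index S a∈S
... | i , i< , e = suc i , s≤s i< , e

applyUpTo-nth : ∀ S → applyUpTo (nth S) (length S) ≡ S
applyUpTo-nth []      = refl
applyUpTo-nth (a ∷ S) = cong (a ∷_) (applyUpTo-nth S)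

enumerate : ∀ S → map (λ x → nth S (x ∸ 1)) (range 1 (length S)) ≡ S
enumerate S = trans (cong (map (λ x → nth S (x ∸ 1))) (sym (applyUpTo-range suc 1 (length S) (λ _ → refl))))
                    (trans (map-applyUpTo suc (λ x → nth S (x ∸ 1)) (length S)) (applyUpTo-nth S))

negValues posValues : List ℕ → ℕ → List ℕ
negValues J n = filter (λ i → T? (i ∈ᵇ J)) (range 1 n)
posValues J n = filter (λ i → T? (not (i ∈ᵇ J))) (range 1 n)

signedBy : List ℕ → ℕ → ℤ
signedBy J x = if x ∈ᵇ J then - (+ x) else + x

sortedLetters-split : ∀ n J → sortedLetters n J ≡ map (λ j → - (+ j)) (negValues J n) ++ map +_ (posValues J n)
sortedLetters-split n J = cong (λ R → map (λ j → - (+ j)) (filter (λ i → T? (i ∈ᵇ J)) R) ++ map +_ (filter (λ i → T? (not (i ∈ᵇ J))) R))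
                               ([n]≡range n)

sortedLetters-signedBy : ∀ n J → sortedLetters n J ≡ map (signedBy J) (negValues J n ++ posValues J n)
sortedLetters-signedBy n J = begin
  sortedLetters n J                                            ≡⟨ sortedLetters-split n J ⟩
  map (λ j → - (+ j)) (negValues J n) ++ map +_ (posValues J n)
    ≡⟨ cong₂ _++_ (map-cong-local (All.map (λ {x} h → cong (λ b → if b then - (+ x) else + x) (sym (T⇒true h))) (AllP.all-filter _ (range 1 n))))
                  (map-cong-local (All.map (λ {x} h → cong (λ b → if b then - (+ x) else + x) (sym (T-not⇒false h))) (AllP.all-filter _ (range 1 n)))) ⟩
  map (signedBy J) (negValues J n) ++ map (signedBy J) (posValues J n) ≡⟨ sym (map-++ (signedBy J) (negValues J n) (posValues J n)) ⟩
  map (signedBy J) (negValues J n ++ posValues J n) ∎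
  where open ≡-Reasoning

sortedLetters-increasing : ∀ n J → Increasing (sortedLetters n J)
sortedLetters-increasing n J = subst Increasing (sym (sortedLetters-split n J))
  (AllPairsP.++⁺ (AllPairsP.map⁺ (AllPairsP.filter⁺ _ (AllPairs.map negatives (range-increasing 1 n))))
                 (AllPairsP.map⁺ (AllPairsP.filter⁺ _ (AllPairs.map (λ (_ , x<y) → <ᵇ-true x<y) (range-increasing 1 n))))
                 (AllP.map⁺ (All.map (λ 1≤x → AllP.map⁺ (All.universal (negative-below 1≤x) _))
                                     (AllP.filter⁺ _ (range-≥ 1 n)))))
  where
  negatives : ∀ {x y} → 1 ≤ x × x < y → ((- (+ x)) <ᴮ (- (+ y))) ≡ true
  negatives {suc x} {suc y} (_ , s≤s x<y) = <ᵇ-true x<y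
  negative-below : ∀ {x} → 1 ≤ x → ∀ y → ((- (+ x)) <ᴮ (+ y)) ≡ true
  negative-below {suc x} _ y = refl

abs-signedBy : ∀ J x → ∣ signedBy J x ∣ ≡ x
abs-signedBy J x with x ∈ᵇ J
... | true  = ∣-i∣≡∣i∣ (+ x)
... | false = refl

Neg-signedBy : ∀ J l → All (1 ≤_) l → Neg (map (signedBy J) l) ≡ filter (λ i → T? (i ∈ᵇ J)) l
Neg-signedBy J []            []         = refl
Neg-signedBy J (suc x ∷ l) (_ ∷ hs) with suc x ∈ᵇ J
... | true  = cong (suc x ∷_) (Neg-signedBy J l hs)
... | false = Neg-signedBy J l hs

abs-sortedLetters : ∀ n J → map ∣_∣ (sortedLetters n J) ↭ range 1 n
abs-sortedLetters n J = subst (_↭ range 1 n) (sym abs-eq) (partition-↭ (_∈ᵇ J) (range 1 n))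
  where
  abs-eq : map ∣_∣ (sortedLetters n J) ≡ negValues J n ++ posValues J n
  abs-eq = trans (cong (map ∣_∣) (sortedLetters-signedBy n J))
                 (trans (sym (map-∘ _)) (map-id-local (All.universal (λ x → abs-signedBy J x) _)))

length-sortedLetters : ∀ n J → length (sortedLetters n J) ≡ n
length-sortedLetters n J = trans (sym (length-map ∣_∣ (sortedLetters n J))) (trans (PermP.↭-length (abs-sortedLetters n J)) (length-range 1 n))

Neg-sortedLetters : ∀ n J → Neg (sortedLetters n J) ↭ negValues J n
Neg-sortedLetters n J = subst (_↭ negValues J n) (sym Neg-eq)
  (PermP.filter-↭ (λ i → T? (i ∈ᵇ J)) (partition-↭ (_∈ᵇ J) (range 1 n)))
  where
  all-pos : All (1 ≤_) (negValues J n ++ posValues J n)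
  all-pos = AllP.++⁺ (AllP.filter⁺ _ (range-≥ 1 n)) (AllP.filter⁺ _ (range-≥ 1 n))
  Neg-eq : Neg (sortedLetters n J) ≡ filter (λ i → T? (i ∈ᵇ J)) (negValues J n ++ posValues J n)
  Neg-eq = trans (cong Neg (sortedLetters-signedBy n J)) (Neg-signedBy J _ all-pos)

rankIn : List ℤ → ℤ → ℕ
rankIn S a = suc (count (_<ᴮ a) S)

st-as-rank : ∀ w S → w ↭ S → st w ≡ map (λ a → + rankIn S a) w
st-as-rank w S w↭S = map-cong (λ a → cong (λ c → + suc c) (count-↭ (_<ᴮ a) w↭S)) w

rank-nth : ∀ S x → Increasing S → 1 ≤ x → x ≤ length S → rankIn S (nth S (x ∸ 1)) ≡ x
rank-nth S (suc x) inc _ x< = cong suc (increasing-rank S x inc x<)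

InRange : ℕ → ℕ → Set
InRange n x = 1 ≤ x × x < 1 + n

range-InRange : ∀ n → All (InRange n) (range 1 n)
range-InRange n = All.zip (range-≥ 1 n , range-< 1 n)

ranks-increasing : ∀ S → Increasing S → map (rankIn S) S ≡ range 1 (length S)
ranks-increasing S inc = begin
  map (rankIn S) S                                                  ≡⟨ cong (map (rankIn S)) (sym (enumerate S)) ⟩
  map (rankIn S) (map (λ x → nth S (x ∸ 1)) (range 1 (length S)))  ≡⟨ sym (map-∘ (range 1 (length S))) ⟩
  map (λ x → rankIn S (nth S (x ∸ 1))) (range 1 (length S))        ≡⟨ map-id-local (All.map (λ (1≤x , x<) → rank-nth S _ inc 1≤x (≤-pred x<))
                                                                                     (range-InRange (length S))) ⟩
  range 1 (length S) ∎
  where open ≡-Reasoning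

SameOn : ℕ → List ℕ → List ℕ → Set
SameOn n J J′ = All (λ i → (i ∈ᵇ J) ≡ (i ∈ᵇ J′)) (range 1 n)

module ShapeOfUJ (n : ℕ) (J : List ℕ) (p : List ℕ) (p↭ : p ↭ range 1 n) where
  S : List ℤ
  S = sortedLetters n J

  letter : ℕ → ℤ
  letter x = nth S (x ∸ 1)

  u w : List ℤ
  u = map +_ p
  w = uJ n u J

  p-InRange : All (InRange n) p
  p-InRange = PermP.All-resp-↭ (↭-sym p↭) (range-InRange n)

  length-u : length u ≡ n
  length-u = trans (length-map +_ p) (trans (PermP.↭-length p↭) (length-range 1 n))

  u-positive : All Pos u
  u-positive = AllP.map⁺ (All.map (λ { {suc m} _ → m , refl }) p-InRange)

  w≡ : w ≡ map letter p
  w≡ = sym (map-∘ p)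

  w↭S : w ↭ S
  w↭S = subst (_↭ S) (sym w≡) (subst (map letter p ↭_) letters (PermP.map⁺ letter p↭))
    where
    letters : map letter (range 1 n) ≡ S
    letters = subst (λ m → map letter (range 1 m) ≡ S) (length-sortedLetters n J) (enumerate S)

  letter-order : ∀ {x y} → InRange n x → InRange n y → (letter y <ᴮ letter x) ≡ (y <ᵇ x)
  letter-order {suc x} {suc y} (_ , s≤s x≤n) (_ , s≤s y≤n) =
    increasing-nth S y x (sortedLetters-increasing n J) (bound y≤n) (bound x≤n)
    where
    bound : ∀ {i} → i < n → i < length S
    bound {i} i<n = subst (i <_) (sym (length-sortedLetters n J)) i<n

  signed : IsSigned n w
  signed = subst (map ∣_∣ w ↭_) (sym ([n]≡range n)) (↭-trans (PermP.map⁺ ∣_∣ w↭S) (abs-sortedLetters n J))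

  st-w : st w ≡ u
  st-w = begin
    st w                                        ≡⟨ st-as-rank w S w↭S ⟩
    map (λ a → + rankIn S a) w                  ≡⟨ cong (map (λ a → + rankIn S a)) w≡ ⟩
    map (λ a → + rankIn S a) (map letter p)     ≡⟨ sym (map-∘ p) ⟩
    map (λ x → + rankIn S (letter x)) p         ≡⟨ map-cong-local (All.map (λ (1≤x , x<) → cong +_ (rank-nth S _ (sortedLetters-increasing n J) 1≤x
                                                       (subst (_ ≤_) (sym (length-sortedLetters n J)) (≤-pred x<)))) p-InRange) ⟩
    u ∎
    where open ≡-Reasoning

  Des-w : Des w ≡ Des u
  Des-w = trans (cong Des w≡) (desFrom-relabel 1 letter +_ p p-InRange letter-order)

  Neg-w : Neg w ↭ negValues J n
  Neg-w = ↭-trans (PermP.map⁺ ∣_∣ (PermP.filter-↭ (λ a → T? (isNeg a)) w↭S)) (Neg-sortedLetters n J)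

  Neg-w-same : SameOn n (Neg w) J
  Neg-w-same = All.map (λ {i} (1≤i , i<) → trans (∈ᵇ-↭ i Neg-w) (∈ᵇ-filter-range (_∈ᵇ J) 1 n i 1≤i i<)) (range-InRange n)

abs-injective : ∀ w {a b} → AllPairs (λ x y → ¬ x ≡ y) (map ∣_∣ w) → a ∈ w → b ∈ w → ∣ a ∣ ≡ ∣ b ∣ → a ≡ b
abs-injective (c ∷ w) (h ∷ hs) (here refl) (here refl) e = refl
abs-injective (c ∷ w) (h ∷ hs) (here refl) (there b∈w) e = ⊥-elim (All.lookup h (∈-map⁺ ∣_∣ b∈w) e)
abs-injective (c ∷ w) (h ∷ hs) (there a∈w) (here refl) e = ⊥-elim (All.lookup h (∈-map⁺ ∣_∣ a∈w) (sym e))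
abs-injective (c ∷ w) (h ∷ hs) (there a∈w) (there b∈w) e = abs-injective w hs a∈w b∈w e

module Reconstruction (n : ℕ) (w : List ℤ) (w-signed : map ∣_∣ w ↭ range 1 n) where
  J : List ℕ
  J = Neg w

  S : List ℤ
  S = sortedLetters n J

  abs-distinct : AllPairs (λ x y → ¬ x ≡ y) (map ∣_∣ w)
  abs-distinct = UniqueNat.Unique-resp-↭ (↭⇒↭ₛ (↭-sym w-signed))
                   (AllPairs.map (λ (_ , x<y) x≡y → <-irrefl x≡y x<y) (range-increasing 1 n))

  letter-sign : ∀ a → a ∈ w → signedBy J ∣ a ∣ ≡ a
  letter-sign -[1+ m ] a∈w rewrite ∈⇒∈ᵇ J (∈-map⁺ ∣_∣ (∈-filter⁺ (λ a → T? (isNeg a)) a∈w tt)) = refl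
  letter-sign (+ zero) a∈w with 0 ∈ᵇ J
  ... | true  = refl
  ... | false = refl
  letter-sign (+ suc m) a∈w with suc m ∈ᵇ J in eq
  ... | false = refl
  ... | true with ∈-map⁻ ∣_∣ (∈ᵇ⇒∈ J eq)
  ... | b , b∈neg , e with ∈-filter⁻ (λ a → T? (isNeg a)) b∈neg
  ... | b∈w , b-neg with abs-injective w abs-distinct a∈w b∈w e
  ... | refl = ⊥-elim b-neg

  w↭S : w ↭ S
  w↭S = subst (_↭ S) w≡ (subst (map (signedBy J) (map ∣_∣ w) ↭_) (sym (sortedLetters-signedBy n J))
          (PermP.map⁺ (signedBy J) (↭-trans w-signed (↭-sym (partition-↭ (_∈ᵇ J) (range 1 n))))))
    where
    w≡ : map (signedBy J) (map ∣_∣ w) ≡ w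
    w≡ = trans (sym (map-∘ w)) (map-id-local (All.tabulate (λ {a} → letter-sign a)))

  S-increasing : Increasing S
  S-increasing = sortedLetters-increasing n J

  nth-rank : ∀ a → a ∈ w → nth S (rankIn S a ∸ 1) ≡ a
  nth-rank a a∈w with nth-index S (PermP.∈-resp-↭ w↭S a∈w)
  ... | i , i< , refl = cong (λ x → nth S (x ∸ 1)) (rank-nth S (suc i) S-increasing (s≤s z≤n) i<)

  reconstruct : uJ n (st w) J ≡ w
  reconstruct = begin
    uJ n (st w) J                                           ≡⟨ cong (λ v → uJ n v J) (st-as-rank w S w↭S) ⟩
    map (λ k → nth S (∣ k ∣ ∸ 1)) (map (λ a → + rankIn S a) w) ≡⟨ sym (map-∘ w) ⟩
    map (λ a → nth S (rankIn S a ∸ 1)) w                    ≡⟨ map-id-local (All.tabulate (λ {a} → nth-rank a)) ⟩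
    w ∎
    where open ≡-Reasoning

  st-permutation : map ∣_∣ (st w) ↭ range 1 n
  st-permutation = subst (_↭ range 1 n) (sym abs-st)
    (subst (map (rankIn S) w ↭_) ranks (PermP.map⁺ (rankIn S) w↭S))
    where
    abs-st : map ∣_∣ (st w) ≡ map (rankIn S) w
    abs-st = trans (cong (map ∣_∣) (st-as-rank w S w↭S)) (sym (map-∘ w))
    ranks : map (rankIn S) S ≡ range 1 n
    ranks = trans (ranks-increasing S S-increasing) (cong (range 1) (length-sortedLetters n J))

symDiffPattern : List ℕ → List ℤ → ℕ → Bool
symDiffPattern J u = flipParity (filter (λ i → T? ((i ∈ᵇ J) xor (i ∈ᵇ Des u))) (range 1 (length u)))

Δ-symDiff-pattern : ∀ n J u → length u ≡ n → ΔSet (symDiff n J (Des u)) u ≡ negateWhere (symDiffPattern J u) 1 u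
Δ-symDiff-pattern n J u len = trans (ΔSet-as-pattern (symDiff n J (Des u)) u)
  (cong (λ R → negateWhere (flipParity (filter (λ i → T? ((i ∈ᵇ J) xor (i ∈ᵇ Des u))) R)) 1 u)
        (trans ([n]≡range n) (cong (range 1) (sym len))))

ΔSet-invariant : {B : Set} (f : ℤ → B) → (∀ a → f (- a) ≡ f a) → ∀ K x → map f (ΔSet K x) ≡ map f x
ΔSet-invariant f f-even K x = trans (cong (map f) (ΔSet-as-pattern K x)) (negateWhere-invariant f f-even (flipParity K) 1 x)

symDiff-cong : ∀ n J J′ B → SameOn n J J′ → symDiff n J B ≡ symDiff n J′ B
symDiff-cong n J J′ B same rewrite [n]≡range n =
  filter-cong-local _ _ (range 1 n) (All.map (cong (_xor (_ ∈ᵇ B))) same)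

uJ-cong : ∀ n u J J′ → SameOn n J J′ → uJ n u J ≡ uJ n u J′
uJ-cong n u J J′ same = cong (λ S → map (λ k → nth S (∣ k ∣ ∸ 1)) u) letters
  where
  letters : sortedLetters n J ≡ sortedLetters n J′
  letters rewrite sortedLetters-split n J | sortedLetters-split n J′
                | filter-cong-local (_∈ᵇ J) (_∈ᵇ J′) (range 1 n) same
                | filter-cong-local (λ i → not (i ∈ᵇ J)) (λ i → not (i ∈ᵇ J′)) (range 1 n) (All.map (cong not) same) = refl

-- On a positive word u of length n, the signed word Δ_{J △ Des u} u determines J ∩ [n]:
-- it determines the sign pattern, and J ⊕ Des u is the pattern's difference sequence.
Δ-symDiff-injective : ∀ n J J′ u → All Pos u → length u ≡ n →
                      ΔSet (symDiff n J (Des u)) u ≡ ΔSet (symDiff n J′ (Des u)) u → SameOn n J J′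
Δ-symDiff-injective n J J′ u pos len e = subst (λ m → All _ (range 1 m)) len (All.map same (range-InRange (length u)))
  where
  P P′ : ℕ → Bool
  P  i = (i ∈ᵇ J) xor (i ∈ᵇ Des u)
  P′ i = (i ∈ᵇ J′) xor (i ∈ᵇ Des u)
  π π′ : ℕ → Bool
  π  = symDiffPattern J u
  π′ = symDiffPattern J′ u
  chain  = flipParity-chain P u
  chain′ = flipParity-chain P′ u
  patterns : negateWhere π 1 u ≡ negateWhere π′ 1 u
  patterns = trans (sym (Δ-symDiff-pattern n J u len)) (trans e (Δ-symDiff-pattern n J′ u len))
  agree : ∀ i → 1 ≤ i → i ≤ 1 + length u → π i ≡ π′ i
  agree i 1≤i i≤ with m≤n⇒m<n∨m≡n i≤
  ... | inj₁ i<  = negateWhere-injective π π′ 1 u pos patterns i 1≤i i<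
  ... | inj₂ refl = trans (parityChain-end π P 1 u chain) (sym (parityChain-end π′ P′ 1 u chain′))
  same : ∀ {i} → InRange (length u) i → (i ∈ᵇ J) ≡ (i ∈ᵇ J′)
  same {i} (1≤i , i<) = xor-injectiveˡ (i ∈ᵇ Des u) (begin
    P i                ≡⟨ xor-move (π (suc i)) (parityChain-step π P 1 u chain i 1≤i i<) ⟩
    π i xor π (suc i)  ≡⟨ cong₂ _xor_ (agree i 1≤i (<⇒≤ i<)) (agree (suc i) (s≤s z≤n) i<) ⟩
    π′ i xor π′ (suc i) ≡⟨ sym (xor-move (π′ (suc i)) (parityChain-step π′ P′ 1 u chain′ i 1≤i i<)) ⟩
    P′ i ∎)
    where open ≡-Reasoning

-- Past the end, nth returns the positive letter + 0.
nth-end : ∀ v → nth v (length v) ≡ + 0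
nth-end []      = refl
nth-end (a ∷ v) = nth-end v

-- signAt v i: whether the letter in position i (from 1) of v is negative; false past the end.
signAt : List ℤ → ℕ → Bool
signAt v i = isNeg (nth v (i ∸ 1))

-- The set J for which Δ_{J △ Des u} u has the signs of v, where u = |v|: position i
-- belongs to J iff the sign changes between positions i and i+1 exactly when i ∉ Des u.
signSet : ℕ → List ℤ → List ℕ
signSet n v = filter (λ i → T? ((signAt v i xor signAt v (suc i)) xor (i ∈ᵇ Des (map +_ (map ∣_∣ v))))) [ n ]

realise-signs : ∀ n v → length v ≡ n →
  let u = map +_ (map ∣_∣ v) in ΔSet (symDiff n (signSet n v) (Des u)) u ≡ v
realise-signs n v len = begin
  ΔSet (symDiff n J (Des u)) u             ≡⟨ Δ-symDiff-pattern n J u (trans length-u len) ⟩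
  negateWhere (symDiffPattern J u) 1 u     ≡⟨ negateWhere-cong _ σ 1 u (λ p 1≤p p< → agree p 1≤p (<⇒≤ p<)) ⟩
  negateWhere σ 1 u                        ≡⟨ cong (negateWhere σ 1) (sym (map-∘ v)) ⟩
  negateWhere σ 1 (map (λ a → + ∣ a ∣) v)  ≡⟨ negateWhere-signs v σ 1 (λ _ _ → refl) ⟩
  v ∎
  where
  open ≡-Reasoning
  u = map +_ (map ∣_∣ v)
  J = signSet n v
  σ = signAt v
  P : ℕ → Bool
  P i = (i ∈ᵇ J) xor (i ∈ᵇ Des u)
  length-u : length u ≡ length v
  length-u = trans (length-map +_ (map ∣_∣ v)) (length-map ∣_∣ v)
  P-is-change : ∀ i → 1 ≤ i → i < 1 + length u → P i ≡ σ i xor σ (suc i)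
  P-is-change i 1≤i i< = trans (cong (_xor (i ∈ᵇ Des u)) member) (xor-cancel _ (i ∈ᵇ Des u))
    where
    member : i ∈ᵇ J ≡ (σ i xor σ (suc i)) xor (i ∈ᵇ Des u)
    member rewrite [n]≡range n = ∈ᵇ-filter-range _ 1 n i 1≤i (subst (λ m → i < 1 + m) (trans length-u len) i<)
  σ-chain : ParityChain σ P 1 u
  σ-chain = parityChain-intro σ P 1 u
    (λ i 1≤i i< → trans (sym (xor-cancel (σ i) (σ (suc i)))) (cong (_xor σ (suc i)) (sym (P-is-change i 1≤i i<))))
    (trans (cong (λ m → isNeg (nth v m)) length-u) (cong isNeg (nth-end v)))
  agree : ∀ p → 1 ≤ p → p ≤ 1 + length u → symDiffPattern J u p ≡ σ p
  agree = parityChain-unique _ σ P 1 u (flipParity-chain P u) σ-chain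

ψ-uJ : ∀ n J p → p ↭ range 1 n → ψ n (uJ n (map +_ p) J) ≡ ΔSet (symDiff n J (Des (map +_ p))) (map +_ p)
ψ-uJ n J p p↭ = trans (cong (λ v → ΔSet (symDiff n (Neg w) (Des v)) v) st-w)
                      (cong (λ K → ΔSet K u) (symDiff-cong n (Neg w) J (Des u) Neg-w-same))
  where open ShapeOfUJ n J p p↭

uJ-weights : ∀ n J p → p ↭ range 1 n →
  let u = map +_ p ; w = uJ n u J ; v = ΔSet (symDiff n J (Des u)) u in ndes w ≡ fdes v × nmaj w ≡ fmaj v
uJ-weights n J p p↭ =
  trans (cong₂ _+_ (cong length Des-w) negCount-w) (trans (proj₁ scan) (cong fdes (sym v≡))) ,
  trans (cong₂ _+_ (cong sum Des-w) negSum-w) (trans (proj₂ scan) (cong fmaj (sym v≡)))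
  where
  open ShapeOfUJ n J p p↭
  v≡ = Δ-symDiff-pattern n J u length-u
  scan = weight-identity (_∈ᵇ J) u u-positive
  negCount-w : negCount w ≡ count (_∈ᵇ J) (range 1 (length u))
  negCount-w = trans (sym (length-map ∣_∣ (filter (λ a → T? (isNeg a)) w)))
                     (trans (PermP.↭-length Neg-w) (cong (λ m → count (_∈ᵇ J) (range 1 m)) (sym length-u)))
  negSum-w : negSum w ≡ sumWhere (_∈ᵇ J) (range 1 (length u))
  negSum-w = trans (sum-↭ Neg-w) (cong (λ m → sumWhere (_∈ᵇ J) (range 1 m)) (sym length-u))

signed-range : ∀ {n w} → IsSigned n w → map ∣_∣ w ↭ range 1 n
signed-range {n} {w} = subst (map ∣_∣ w ↭_) ([n]≡range n)

abs-ψ : ∀ n w → map (λ a → + ∣ a ∣) (ψ n w) ≡ st w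
abs-ψ n w = trans (ΔSet-invariant (λ a → + ∣ a ∣) (λ a → cong +_ (∣-i∣≡∣i∣ a)) (symDiff n (Neg w) (Des (st w))) (st w)) (sym (map-∘ w))

st-positive : ∀ w → All Pos (st w)
st-positive w = AllP.map⁺ (All.universal (λ _ → _ , refl) w)

uJ-correspondence : ∀ n u J → IsPerm n u →
    IsSigned n (uJ n u J)
  × ψ n (uJ n u J) ≡ ΔSet (symDiff n J (Des u)) u
  × ndes (uJ n u J) ≡ fdes (ΔSet (symDiff n J (Des u)) u)
  × nmaj (uJ n u J) ≡ fmaj (ΔSet (symDiff n J (Des u)) u)
uJ-correspondence n u J u-perm with PermP.↭-map-inv +_ (↭-sym u-perm)
... | p , refl , [n]↭p = ShapeOfUJ.signed n J p p↭ , ψ-uJ n J p p↭ , uJ-weights n J p p↭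
  where
  p↭ : p ↭ range 1 n
  p↭ = ↭-sym (subst (_↭ p) ([n]≡range n) [n]↭p)

-- Part 2: ψ maps B_n into B_n, because |ψ w| = st w is a permutation.
ψ-closed : ∀ n w → IsSigned n w → IsSigned n (ψ n w)
ψ-closed n w w-signed = subst (map ∣_∣ (ψ n w) ↭_) (sym ([n]≡range n))
  (subst (_↭ range 1 n) (sym (ΔSet-invariant ∣_∣ ∣-i∣≡∣i∣ (symDiff n (Neg w) (Des (st w))) (st w)))
         (Reconstruction.st-permutation n w (signed-range w-signed)))

-- ψ w determines st w (its absolute values) and then Neg w ∩ [n] (its signs); by
-- reconstruction these determine w.
ψ-injective : ∀ n w v → IsSigned n w → IsSigned n v → ψ n w ≡ ψ n v → w ≡ v
ψ-injective n w v w-signed v-signed e = begin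
  w                    ≡⟨ sym (Reconstruction.reconstruct n w (signed-range w-signed)) ⟩
  uJ n (st w) (Neg w)  ≡⟨ uJ-cong n (st w) (Neg w) (Neg v) same-signs ⟩
  uJ n (st w) (Neg v)  ≡⟨ cong (λ s → uJ n s (Neg v)) same-st ⟩
  uJ n (st v) (Neg v)  ≡⟨ Reconstruction.reconstruct n v (signed-range v-signed) ⟩
  v ∎
  where
  open ≡-Reasoning
  same-st : st w ≡ st v
  same-st = trans (sym (abs-ψ n w)) (trans (cong (map (λ a → + ∣ a ∣)) e) (abs-ψ n v))
  length-st : length (st w) ≡ n
  length-st = trans (length-map _ w) (trans (sym (length-map ∣_∣ w))
                    (trans (PermP.↭-length (signed-range w-signed)) (length-range 1 n)))
  same-signs : SameOn n (Neg w) (Neg v)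
  same-signs = Δ-symDiff-injective n (Neg w) (Neg v) (st w) (st-positive w) length-st
    (trans e (cong (λ s → ΔSet (symDiff n (Neg v) (Des s)) s) (sym same-st)))

ψ-surjective : ∀ n v → IsSigned n v → Σ[ w ∈ List ℤ ] (IsSigned n w × ψ n w ≡ v)
ψ-surjective n v v-signed =
  uJ n u J , ShapeOfUJ.signed n J p p↭ , trans (ψ-uJ n J p p↭) (realise-signs n v length-v)
  where
  p = map ∣_∣ v
  u = map +_ p
  J = signSet n v
  p↭ = signed-range v-signed
  length-v : length v ≡ n
  length-v = trans (sym (length-map ∣_∣ v)) (trans (PermP.↭-length p↭) (length-range 1 n))

theorem10 : (n : ℕ) →
    -- weight preservation and the form of the correspondence, for all u ∈ S_n, J ⊆ [n]
    ((u : List ℤ) (J : List ℕ) → IsPerm n u → J ⊆[ n ] →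
        IsSigned n (uJ n u J)
      × ψ n (uJ n u J) ≡ ΔSet (symDiff n J (Des u)) u
      × ndes (uJ n u J) ≡ fdes (ΔSet (symDiff n J (Des u)) u)
      × nmaj (uJ n u J) ≡ fmaj (ΔSet (symDiff n J (Des u)) u))
  -- ψ maps B_n to B_n
  × ((w : List ℤ) → IsSigned n w → IsSigned n (ψ n w))
  -- ψ is injective on B_n
  × ((w v : List ℤ) → IsSigned n w → IsSigned n v → ψ n w ≡ ψ n v → w ≡ v)
  -- ψ is surjective onto B_n
  × ((v : List ℤ) → IsSigned n v → Σ[ w ∈ List ℤ ] (IsSigned n w × ψ n w ≡ v))
theorem10 n = (λ u J u-perm _ → uJ-correspondence n u J u-perm) , ψ-closed n , ψ-injective n , ψ-surjective n
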